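{- Let $\vdash$ be a regular entailment relation for a commutative preordered group $G$ and let $a_1,\dots,a_n\in G$ ($n\geqslant1$). If $a_1+\dots+a_n=0$, then $a_1,\dots,a_n\vdash 0$.
   Context: A commutative preordered group is an abelian group $G$ with a preorder $\leqslant$ such that $a\leqslant b$ implies $a+c\leqslant b+c$. $A,B,A',B'$ denote nonempty finite subsets of $G$; $a$ stands for $\{a\}$, commas denote unions (so $a_1,\dots,a_n$ is the set $\{a_1,\dots,a_n\}$), $A+y=\{a+y:a\in A\}$. A regular entailment relation for $G$ is a relation $A\vdash B$ between nonempty finite subsets such that: (R1) $A\vdash B$ if $A\supseteq A'$, $B\supseteq B'$ and $A'\vdash B'$; (R2) $A\vdash B$ if $A,y\vdash B$ and $A\vdash B,y$; (R3) $a\vdash b$ if $a\leqslant b$; (R4) $A\vdash B$ if $A+y\vdash B+y$; (R5) $a+u,b+v\vdash a+b,u+v$ for all $a,b,u,v\in G$. -}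

module Defs where

open import Level using (Level; _⊔_; suc)
open import Algebra.Bundles using (AbelianGroup)
open import Data.List using (List; []; _∷_; foldr)
open import Data.List.NonEmpty using (List⁺; _∷_; [_]; _⁺++⁺_; toList; map)
open import Data.Nat using (ℕ)
open import Relation.Binary.Core using (Rel)
open import Relation.Binary.Structures using (IsPreorder)
import Data.List.Membership.Setoid as Mem

record PreorderedAbelianGroup (c ℓ₁ ℓ₂ : Level) : Set (Level.suc (c ⊔ ℓ₁ ⊔ ℓ₂)) where
  field
    abelianGroup : AbelianGroup c ℓ₁
  open AbelianGroup abelianGroup public
  field
    _≤_        : Rel Carrier ℓ₂
    isPreorder : IsPreorder _≈_ _≤_
    ≤-+-compat : ∀ {a b} c → a ≤ b → (a ∙ c) ≤ (b ∙ c)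

module _ {c ℓ₁ ℓ₂ : Level} (G : PreorderedAbelianGroup c ℓ₁ ℓ₂) where
  open PreorderedAbelianGroup G

  -- Nonempty finite subsets of G are represented by nonempty lists,
  -- read up to (setoid) membership; order and repetitions are irrelevant
  -- because (R1) is stated via membership inclusion.
  FinSet : Set c
  FinSet = List⁺ Carrier

  _∈_ : Carrier → FinSet → Set (c ⊔ ℓ₁)
  x ∈ A = Mem._∈_ setoid x (toList A)

  _⊇_ : FinSet → FinSet → Set (c ⊔ ℓ₁)
  A ⊇ A' = ∀ {x} → x ∈ A' → x ∈ A

  _,,_ : FinSet → FinSet → FinSet
  A ,, B = A ⁺++⁺ B

  ⟪_⟫ : Carrier → FinSet
  ⟪ a ⟫ = [ a ]

  _+ₛ_ : FinSet → Carrier → FinSet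
  A +ₛ y = map (λ a → a ∙ y) A

  record IsRegularEntailment {ℓ : Level} (_⊢_ : FinSet → FinSet → Set ℓ)
         : Set (c ⊔ ℓ₁ ⊔ ℓ₂ ⊔ ℓ) where
    field
      R1 : ∀ {A B A' B'} → A ⊇ A' → B ⊇ B' → A' ⊢ B' → A ⊢ B
      R2 : ∀ {A B} y → (A ,, ⟪ y ⟫) ⊢ B → A ⊢ (B ,, ⟪ y ⟫) → A ⊢ B
      R3 : ∀ {a b} → a ≤ b → ⟪ a ⟫ ⊢ ⟪ b ⟫
      R4 : ∀ {A B} y → (A +ₛ y) ⊢ (B +ₛ y) → A ⊢ B
      R5 : ∀ a b u v → (⟪ a ∙ u ⟫ ,, ⟪ b ∙ v ⟫) ⊢ (⟪ a ∙ b ⟫ ,, ⟪ u ∙ v ⟫)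

  sum⁺ : List⁺ Carrier → Carrier
  sum⁺ (a ∷ as) = a ∙ foldr _∙_ ε as

-- By induction on n one proves  a₁,…,aₙ ⊢ 0, a₁+…+aₙ.  Axiom R5 with u = v = 0
-- gives  a, s ⊢ 0, a+s;  cutting (R2) on s = a₂+…+aₙ against the induction
-- hypothesis  a₂,…,aₙ ⊢ 0, s  yields the claim for a₁,…,aₙ.  When the sum is 0,
-- the two conclusions coincide.
module Submission where

open import Defs
open import Data.List using ([]; _∷_)
open import Data.List.NonEmpty using (List⁺; _∷_; toList)
open import Data.List.Relation.Unary.Any using (here; there)
open import Function using (id)
open import Relation.Binary.Structures using (IsPreorder)
open import Data.List.Relation.Binary.Subset.Setoid.Properties using (xs⊆xs++ys; xs⊆ys++xs; ++⁺; ⊆-refl)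

module RegularEntailment {c ℓ₁ ℓ₂ ℓ} (G : PreorderedAbelianGroup c ℓ₁ ℓ₂)
         {_⊢_ : FinSet G → FinSet G → Set ℓ} (R : IsRegularEntailment G _⊢_) where
  open PreorderedAbelianGroup G
  open IsRegularEntailment R

  infixr 5 _∪_
  _∪_ : FinSet G → FinSet G → FinSet G
  _∪_ = _,,_ G

  ⟨_⟩ : Carrier → FinSet G
  ⟨_⟩ = ⟪_⟫ G

  ⊢-cut : ∀ {X Y C} s → (X ∪ ⟨ s ⟩) ⊢ C → Y ⊢ (C ∪ ⟨ s ⟩) → (X ∪ Y) ⊢ C
  ⊢-cut {X} {Y} s X,s⊢C Y⊢C,s =
    R2 s (R1 (++⁺ setoid (xs⊆xs++ys setoid (toList X) (toList Y)) (⊆-refl setoid))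
             id X,s⊢C)
         (R1 (xs⊆ys++xs setoid (toList Y) (toList X)) id Y⊢C,s)

  pair⊢ε,∙ : ∀ a b → (⟨ a ⟩ ∪ ⟨ b ⟩) ⊢ (⟨ ε ⟩ ∪ ⟨ a ∙ b ⟩)
  pair⊢ε,∙ a b = R1 {A' = ⟨ a ∙ ε ⟩ ∪ ⟨ b ∙ ε ⟩} {B' = ⟨ a ∙ b ⟩ ∪ ⟨ ε ∙ ε ⟩}
    (λ { (here p) → here (trans p (identityʳ a))
       ; (there (here p)) → there (here (trans p (identityʳ b))) })
    (λ { (here p) → there (here p)
       ; (there (here p)) → here (trans p (identityʳ ε)) })
    (R5 a b ε ε)

  ⊢-merge : ∀ {A x y} → x ≈ y → A ⊢ (⟨ y ⟩ ∪ ⟨ x ⟩) → A ⊢ ⟨ y ⟩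
  ⊢-merge x≈y = R1 id (λ { (here p) → here p ; (there (here p)) → here (trans p x≈y) })

  ⊢ε,sum⁺ : ∀ a as → (a ∷ as) ⊢ (⟨ ε ⟩ ∪ ⟨ sum⁺ G (a ∷ as) ⟩)
  ⊢ε,sum⁺ a [] =
    R1 id (λ { (here p) → there (here p) ; (there ()) })
       (R3 (IsPreorder.reflexive isPreorder (sym (identityʳ a))))
  ⊢ε,sum⁺ a (b ∷ bs) =
    -- ⟨ a ⟩ ∪ (b ∷ bs) reduces to a ∷ b ∷ bs.
    ⊢-cut {X = ⟨ a ⟩} s (pair⊢ε,∙ a s) (R1 id ε,s⊆ε,a∙s,s (⊢ε,sum⁺ b bs))
    where
    s : Carrier
    s = sum⁺ G (b ∷ bs)
    ε,s⊆ε,a∙s,s : _⊇_ G ((⟨ ε ⟩ ∪ ⟨ a ∙ s ⟩) ∪ ⟨ s ⟩) (⟨ ε ⟩ ∪ ⟨ s ⟩)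
    ε,s⊆ε,a∙s,s (here p) = here p
    ε,s⊆ε,a∙s,s (there (here p)) = there (there (here p))

corollary1p12 : ∀ {c ℓ₁ ℓ₂ ℓ} (G : PreorderedAbelianGroup c ℓ₁ ℓ₂)
                (_⊢_ : FinSet G → FinSet G → Set ℓ) →
                IsRegularEntailment G _⊢_ →
                (as : List⁺ (PreorderedAbelianGroup.Carrier G)) →
                PreorderedAbelianGroup._≈_ G (sum⁺ G as) (PreorderedAbelianGroup.ε G) →
                as ⊢ ⟪_⟫ G (PreorderedAbelianGroup.ε G)
corollary1p12 G _⊢_ R (a ∷ as) Σ≈ε =
  RegularEntailment.⊢-merge G R Σ≈ε (RegularEntailment.⊢ε,sum⁺ G R a as)
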